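{- Let $\mathcal{K}$ be a simplicial complex and let $\sigma = A_1 \sqcup A_2 \sqcup \cdots \sqcup A_k \sqcup C$ (disjoint union) be a facet of $\mathcal{K}$, where $A_j = \{a^j_1, \ldots, a^j_{l_j}\}$ for $1 \le j \le k$. Suppose $\{a^i_s, a^j_t\}$ is a free face of $\sigma$ in $\mathcal{K}$ for all $i \neq j$, $s \in \{1,\dots,l_i\}$ and $t \in \{1,\dots,l_j\}$. Then: (1) If $C = \emptyset$, then $\sigma \searrow \langle A_1, \ldots, A_k, \{a^1_{l_1}, a^k_{l_k}\}, \{a^2_{l_2}, a^k_{l_k}\}, \ldots, \{a^{k-1}_{l_{k-1}}, a^k_{l_k}\} \rangle$. (2) If $C \neq \emptyset$, then $\sigma \searrow \langle A_1 \sqcup C, \ldots, A_k \sqcup C \rangle$.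
   Context: A simplicial complex is a collection of finite sets closed under taking subsets (the empty set is always a simplex); facets are maximal simplices. If $\sigma \subsetneq \tau$ are simplices of $\mathcal{K}$ and $\tau$ is the only maximal simplex of $\mathcal{K}$ containing $\sigma$, then $\sigma$ is called a free face of $\tau$ and $(\sigma,\tau)$ a collapsible pair; the elementary simplicial collapse removes all simplices $\gamma$ with $\sigma \subseteq \gamma \subseteq \tau$. Writing $\sigma \searrow \langle B_1, \dots, B_r\rangle$ for a facet $\sigma$ means that, by a sequence of such elementary collapses performed inside $\mathcal{K}$, the simplex $\sigma$ (together with its faces) is collapsed onto the subcomplex whose faces are $B_1, \dots, B_r$ and all their subsets. -}

module Defs where

open import Level using (0ℓ)
open import Data.Nat using (ℕ; zero; suc; _<_)
open import Data.Fin using (Fin; fromℕ; inject₁)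
open import Data.List using (List; map; allFin; _++_)
open import Data.List.Relation.Unary.Any using (Any)
open import Data.Product using (Σ; _×_; ∃; ∃-syntax; _,_)
open import Relation.Nullary using (¬_)
open import Relation.Binary.PropositionalEquality using (_≡_)
open import Function.Bundles using (_⇔_)
open import Data.Fin.Subset public
  using (Subset; _∈_; _∉_; _⊆_; _⊂_; ⁅_⁆; _∪_; ⋃)
  renaming (⊥ to ∅)

Complex : ℕ → Set₁
Complex n = Subset n → Set

IsComplex : ∀ {n} → Complex n → Set
IsComplex K = K ∅ × (∀ σ τ → σ ⊆ τ → K τ → K σ)

Facet : ∀ {n} → Complex n → Subset n → Set
Facet K τ = K τ × (∀ ρ → K ρ → τ ⊆ ρ → ρ ≡ τ)

FreeFace : ∀ {n} → Complex n → Subset n → Subset n → Set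
FreeFace K σ τ = σ ⊂ τ × Facet K τ × (∀ ρ → Facet K ρ → σ ⊆ ρ → ρ ≡ τ)

ElemCollapse : ∀ {n} → Complex n → Complex n → Set
ElemCollapse K L =
  ∃[ σ ] ∃[ τ ] (FreeFace K σ τ × (∀ γ → L γ ⇔ (K γ × ¬ (σ ⊆ γ × γ ⊆ τ))))

-- K ↘ L : a (possibly empty) sequence of elementary collapses from K to L
-- (the final complex is determined up to equality of membership)
data _↘_ {n} (K L : Complex n) : Set₁ where
  done : (∀ γ → K γ ⇔ L γ) → K ↘ L
  step : (K' : Complex n) → ElemCollapse K K' → K' ↘ L → K ↘ L

Spanned : ∀ {n} → List (Subset n) → Subset n → Set
Spanned Bs γ = Any (γ ⊆_) Bs

-- σ ↘ ⟨B₁,…,B_r⟩ inside K: by elementary collapses in K, the faces of σ that are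
-- not faces of any B_i are removed and everything else of K is kept.
CollapsesOnto : ∀ {n} → Complex n → Subset n → List (Subset n) → Set₁
CollapsesOnto K σ Bs = K ↘ (λ γ → K γ × (γ ⊆ σ → Spanned Bs γ))

pair : ∀ {n} → Fin n → Fin n → Subset n
pair x y = ⁅ x ⁆ ∪ ⁅ y ⁆

-- the block A_j = {a^j_1,…,a^j_{l_j}} given a labelling a (j , s) = a^j_s
block : ∀ {n k} (l : Fin k → ℕ) → (Σ (Fin k) (λ j → Fin (l j)) → Fin n) → Fin k → Subset n
block l a j = ⋃ (map (λ s → ⁅ a (j , s) ⁆) (allFin (l j)))

lastIdx : (m : ℕ) → 0 < m → Fin m
lastIdx (suc m) _ = fromℕ m

-- generators for part (1): A_1,…,A_k, {a^j_{l_j}, a^k_{l_k}} for j < k  (k = suc k')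
gens₁ : ∀ {n} k' (l : Fin (suc k') → ℕ) → (Σ (Fin (suc k')) (λ j → Fin (l j)) → Fin n)
        → (∀ j → 0 < l j) → List (Subset n)
gens₁ k' l a nz =
  map (block l a) (allFin (suc k'))
  ++ map (λ j → pair (a (inject₁ j , lastIdx (l (inject₁ j)) (nz (inject₁ j))))
                     (a (fromℕ k' , lastIdx (l (fromℕ k')) (nz (fromℕ k')))))
         (allFin k')

gens₂ : ∀ {n k} (l : Fin k → ℕ) → (Σ (Fin k) (λ j → Fin (l j)) → Fin n)
        → Subset n → List (Subset n)
gens₂ {k = k} l a C = map (λ j → block l a j ∪ C) (allFin k)

-- Call a face crossing when it contains vertices of two different blocks.  Every crossing
-- edge is a free face of σ, so every face of K containing a crossing face lies in σ.  For an
-- apex c ∉ S, the pairs (ρ , ρ ∪ {c}) with ρ ⊆ S crossing can then be collapsed one after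
-- another, larger ρ first: when ρ's turn comes, ρ ∪ {c} is the only facet above it.
-- For (2) one round with apex c ∈ C and S = σ ∖ c removes exactly the crossing faces of σ, and
-- the remaining faces of σ are the faces of the A_j ⊔ C.  For (1) a round with apex
-- v = a^k_{l_k} leaves, among the crossing faces, only those made of v and vertices of a single
-- A_j; one more round for each j < k, with apex a^j_{l_j} and S = (A_j ∖ a^j_{l_j}) ∪ {v},
-- leaves of these only the edge {a^j_{l_j}, v}.

module Submission where

open import Defs
open import Data.Nat using (ℕ; zero; suc; _<_; _≤_; _+_)
import Data.Nat.Properties as ℕ
open import Data.Bool using () renaming (_≟_ to _≟ᵇ_)
open import Data.Fin using (Fin; fromℕ; inject₁; lower₁; toℕ) renaming (_≟_ to _≟ᶠ_)
open import Data.Fin.Properties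
  using (any?; fromℕ≢inject₁; inject₁-injective; inject₁-lower₁; toℕ-fromℕ; toℕ-injective)
open import Data.Fin.Subset using (_─_; _-_; _∩_; ∣_∣; Nonempty; inside; outside)
open import Data.Fin.Subset.Properties
  using (_∈?_; _⊆?_; ⊆-refl; ⊆-trans; ⊆-antisym; p⊆p∪q; x∈p∪q⁺; x∈p∪q⁻; x∈p∩q⁺; x∈p∩q⁻; x∈⁅x⁆; x∈⁅y⁆⇒x≡y;
         x∉⁅y⁆⇒x≢y; drop-∷-⊆; p─q⊆p; q⊆p∪q; p∩q⊆p; p∩q⊆q; ∉⊥; x∈p∧x≢y⇒x∈p-y; ∣p∣≤n;
         p⊂q⇒∣p∣<∣q∣; nonempty?; Empty-unique)
open import Data.List using (List; []; _∷_; allFin; map; _++_)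
open import Data.List.Membership.Propositional using (lose) renaming (_∈_ to _∈ₗ_; _∉_ to _∉ₗ_)
open import Data.List.Membership.Propositional.Properties using (∈-allFin)
open import Data.List.Relation.Unary.Any as Any using (Any; here; there)
import Data.List.Relation.Unary.Any.Properties as Any
open import Data.List.Relation.Unary.All as All using (All; []; _∷_)
import Data.List.Relation.Unary.All.Properties as All
open import Data.List.Relation.Unary.AllPairs as AllPairs using (AllPairs; []; _∷_)
import Data.List.Relation.Unary.AllPairs.Properties as AllPairs
open import Data.List.Relation.Unary.Unique.Propositional.Properties using (allFin⁺)
open import Data.Product using (Σ; _×_; ∃; ∃-syntax; _,_; proj₁; proj₂)
import Data.Product as Product
open import Data.Sum using (_⊎_; inj₁; inj₂)
import Data.Sum as Sum
open import Data.Empty using (⊥; ⊥-elim)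
open import Data.Vec using ([]; _∷_)
import Data.Vec
open import Data.Vec.Properties using (≡-dec)
open import Relation.Nullary using (¬_; Dec; yes; no; ¬?; contradiction)
open import Relation.Nullary.Decidable using (decidable-stable; ¬¬-excluded-middle; _×-dec_; map′)
open import Relation.Unary using (Decidable)
open import Relation.Binary.Definitions using (DecidableEquality)
open import Relation.Binary.PropositionalEquality using (_≡_; _≢_; refl; sym; trans; cong; subst)
open import Function.Bundles using (_⇔_; mk⇔; Equivalence)
import Function.Properties.Equivalence as ⇔
open import Function.Definitions using (Injective)
open import Function using (_∘_; case_of_)

open Equivalence using (to; from)

private
  variable
    n : ℕ
    x y z : Fin n
    p q γ ρ : Subset n

_≟ₛ_ : DecidableEquality (Subset n)
_≟ₛ_ = ≡-dec _≟ᵇ_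

x∈p─q⁻ : ∀ (p q : Subset n) → x ∈ p ─ q → x ∈ p × x ∉ q
x∈p─q⁻ (s ∷ p) (t ∷ q) (Data.Vec.there m) =
  Product.map Data.Vec.there (λ x∉q → λ { (Data.Vec.there x∈q) → x∉q x∈q }) (x∈p─q⁻ p q m)
x∈p─q⁻ (inside ∷ p) (outside ∷ q) Data.Vec.here = Data.Vec.here , λ ()

x∈p-y⁻ : x ∈ p - y → x ∈ p × x ≢ y
x∈p-y⁻ {p = p} {y = y} m = Product.map₂ x∉⁅y⁆⇒x≢y (x∈p─q⁻ p ⁅ y ⁆ m)

x∈p∪⁅y⁆⁻ : x ∈ p ∪ ⁅ y ⁆ → x ∈ p ⊎ x ≡ y
x∈p∪⁅y⁆⁻ {p = p} {y = y} m = Sum.map₂ (x∈⁅y⁆⇒x≡y y) (x∈p∪q⁻ p ⁅ y ⁆ m)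

y∈p∪⁅y⁆ : y ∈ p ∪ ⁅ y ⁆
y∈p∪⁅y⁆ {y = y} = x∈p∪q⁺ (inj₂ (x∈⁅x⁆ y))

x∈pair⁻ : x ∈ pair y z → x ≡ y ⊎ x ≡ z
x∈pair⁻ {y = y} {z = z} m = Sum.map (x∈⁅y⁆⇒x≡y y) (x∈⁅y⁆⇒x≡y z) (x∈p∪q⁻ ⁅ y ⁆ ⁅ z ⁆ m)

pair⊆ : y ∈ p → z ∈ p → pair y z ⊆ p
pair⊆ y∈p z∈p m with x∈pair⁻ m
... | inj₁ refl = y∈p
... | inj₂ refl = z∈p

x∈⋃⁻ : ∀ (ps : List (Subset n)) → x ∈ ⋃ ps → Any (x ∈_) ps
x∈⋃⁻ [] m = ⊥-elim (∉⊥ m)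
x∈⋃⁻ (p ∷ ps) m with x∈p∪q⁻ p (⋃ ps) m
... | inj₁ x∈p = here x∈p
... | inj₂ x∈⋃ps = there (x∈⋃⁻ ps x∈⋃ps)

x∈⋃⁺ : ∀ {ps : List (Subset n)} → Any (x ∈_) ps → x ∈ ⋃ ps
x∈⋃⁺ (here m) = x∈p∪q⁺ (inj₁ m)
x∈⋃⁺ (there m) = x∈p∪q⁺ (inj₂ (x∈⋃⁺ m))

⊆-∩∪⁅⁆ : ∀ {S : Subset n} → (∀ {x} → x ∈ γ → x ≢ y → x ∈ S) → γ ⊆ (γ ∩ S) ∪ ⁅ y ⁆
⊆-∩∪⁅⁆ {y = y} h {x} m with x ≟ᶠ y
... | yes refl = y∈p∪⁅y⁆
... | no x≢y = p⊆p∪q _ (x∈p∩q⁺ (m , h m x≢y))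

x∈p∪⁅y⁆∧x≢y⇒x∈p : x ∈ p ∪ ⁅ y ⁆ → x ≢ y → x ∈ p
x∈p∪⁅y⁆∧x≢y⇒x∈p m x≢y = Sum.[ (λ x∈p → x∈p) , (λ x≡y → contradiction x≡y x≢y) ] (x∈p∪⁅y⁆⁻ m)

p⊆p-y∪⁅y⁆ : p ⊆ (p - y) ∪ ⁅ y ⁆
p⊆p-y∪⁅y⁆ {y = y} {x} m with x ≟ᶠ y
... | yes refl = y∈p∪⁅y⁆
... | no x≢y = p⊆p∪q _ (x∈p∧x≢y⇒x∈p-y m x≢y)

∪⁅⁆⊆ : p ⊆ q → y ∈ q → p ∪ ⁅ y ⁆ ⊆ q
∪⁅⁆⊆ p⊆q y∈q m = Sum.[ p⊆q , (λ { refl → y∈q }) ] (x∈p∪⁅y⁆⁻ m)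

any-map-allFin⁺ : ∀ {m} {B : Set} {Q : B → Set} {f : Fin m → B} i → Q (f i) → Any Q (map f (allFin m))
any-map-allFin⁺ i q = Any.map⁺ (lose (∈-allFin i) q)

any-map-allFin⁻ : ∀ {m} {B : Set} {Q : B → Set} {f : Fin m → B} → Any Q (map f (allFin m)) → ∃[ i ] Q (f i)
any-map-allFin⁻ = Any.satisfied ∘ Any.map⁻

≢∅⇒Nonempty : p ≢ ∅ → Nonempty p
≢∅⇒Nonempty {p = p} p≢∅ = decidable-stable (nonempty? p) (p≢∅ ∘ Empty-unique)

⊆∧≢⇒⊂ : p ⊆ q → q ≢ p → p ⊂ q
⊆∧≢⇒⊂ {p = p} {q = q} p⊆q q≢p with any? (λ x → (x ∈? q) ×-dec ¬? (x ∈? p))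
... | yes (x , x∈q , x∉p) = p⊆q , x , x∈q , x∉p
... | no ∄ = ⊥-elim (q≢p (⊆-antisym q⊆p p⊆q))
  where
  q⊆p : q ⊆ p
  q⊆p {x} x∈q = decidable-stable (x ∈? p) (λ x∉p → ∄ (x , x∈q , x∉p))

subsets : ∀ n → List (Subset n)
subsets zero = [] ∷ []
subsets (suc n) = map (inside ∷_) (subsets n) ++ map (outside ∷_) (subsets n)

∈-subsets : ∀ (p : Subset n) → p ∈ₗ subsets n
∈-subsets [] = here refl
∈-subsets {suc n} (inside ∷ p) =
  Any.++⁺ˡ (Any.map⁺ (Any.map (cong (inside ∷_)) (∈-subsets p)))
∈-subsets {suc n} (outside ∷ p) =
  Any.++⁺ʳ (map (inside ∷_) (subsets n)) (Any.map⁺ (Any.map (cong (outside ∷_)) (∈-subsets p)))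

NotProperSubset : Subset n → Subset n → Set
NotProperSubset p q = p ⊆ q → p ≡ q

subsets-supersets-first : ∀ n → AllPairs NotProperSubset (subsets n)
subsets-supersets-first zero = [] ∷ []
subsets-supersets-first (suc n) =
  AllPairs.++⁺ (AllPairs.map⁺ (AllPairs.map (∷-notProperSubset inside) ih))
               (AllPairs.map⁺ (AllPairs.map (∷-notProperSubset outside) ih))
               (inside-notProperSubset-outside (subsets n) (subsets n))
  where
  ih : AllPairs NotProperSubset (subsets n)
  ih = subsets-supersets-first n
  ∷-notProperSubset : ∀ s → NotProperSubset p q → NotProperSubset (s ∷ p) (s ∷ q)
  ∷-notProperSubset s nb s∷p⊆s∷q = cong (s ∷_) (nb (drop-∷-⊆ s∷p⊆s∷q))
  inside-notProperSubset-outside : ∀ (ps qs : List (Subset n)) →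
    All (λ p → All (NotProperSubset p) (map (outside ∷_) qs)) (map (inside ∷_) ps)
  inside-notProperSubset-outside [] qs = []
  inside-notProperSubset-outside (p ∷ ps) qs =
    All.map⁺ (All.tabulate (λ _ → ⊥-elim ∘ inside∷⊈outside∷)) ∷ inside-notProperSubset-outside ps qs
    where
    inside∷⊈outside∷ : ¬ (inside ∷ p ⊆ outside ∷ q)
    inside∷⊈outside∷ ⊆′ with ⊆′ Data.Vec.here
    ... | ()

-- Collapses

infix 4 _≐_
_≐_ : Complex n → Complex n → Set
K ≐ L = ∀ γ → K γ ⇔ L γ

module _ {K L : Complex n} (K≐L : K ≐ L) where

  facet-resp-≐ : Facet L γ → Facet K γ
  facet-resp-≐ (Lγ , max) = from (K≐L _) Lγ , λ ρ Kρ γ⊆ρ → max ρ (to (K≐L ρ) Kρ) γ⊆ρ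

  freeFace-resp-≐ : FreeFace L ρ γ → FreeFace K ρ γ
  freeFace-resp-≐ (ρ⊂γ , facet , unique) =
    ρ⊂γ , facet-resp-≐ facet ,
    λ τ facetKτ ρ⊆τ → unique τ (facet-resp-≐′ facetKτ) ρ⊆τ
    where
    facet-resp-≐′ : ∀ {τ} → Facet K τ → Facet L τ
    facet-resp-≐′ (Kτ , max) = to (K≐L _) Kτ , λ ρ Lρ τ⊆ρ → max ρ (from (K≐L ρ) Lρ) τ⊆ρ

  elemCollapse-resp-≐ : ∀ {M} → ElemCollapse L M → ElemCollapse K M
  elemCollapse-resp-≐ (ρ , τ , free , M⇔) = ρ , τ , freeFace-resp-≐ free ,
    λ γ → ⇔.trans (M⇔ γ) (mk⇔ (Product.map₁ (from (K≐L γ))) (Product.map₁ (to (K≐L γ))))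

  ↘-respˡ-≐ : ∀ {M} → L ↘ M → K ↘ M
  ↘-respˡ-≐ (done L≐M) = done (λ γ → ⇔.trans (K≐L γ) (L≐M γ))
  ↘-respˡ-≐ (step L′ c r) = step L′ (elemCollapse-resp-≐ c) r

↘-trans : ∀ {K L M : Complex n} → K ↘ L → L ↘ M → K ↘ M
↘-trans (done K≐L) L↘M = ↘-respˡ-≐ K≐L L↘M
↘-trans (step K′ c K′↘L) L↘M = step K′ c (↘-trans K′↘L L↘M)

↘-respʳ-≐ : ∀ {K L M : Complex n} → K ↘ L → L ≐ M → K ↘ M
↘-respʳ-≐ K↘L L≐M = ↘-trans K↘L (done L≐M)

module _ {n} (K : Complex n) where

  -- Membership in K is not decidable, so a facet above γ is only found under double negation;
  -- the fuel m bounds how many vertices γ can still gain.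
  ¬¬-facet-above : ∀ m {γ} → n ≤ m + ∣ γ ∣ → K γ → ¬ ¬ (∃[ F ] Facet K F × γ ⊆ F)
  ¬¬-facet-above m {γ} bound Kγ ¬facet = ¬¬-excluded-middle λ
    { (no ¬larger) → ¬facet (γ , (Kγ , maximal ¬larger) , ⊆-refl)
    ; (yes (ρ , Kρ , γ⊆ρ , ρ≢γ)) → no-larger m bound Kρ γ⊆ρ (p⊂q⇒∣p∣<∣q∣ (⊆∧≢⇒⊂ γ⊆ρ ρ≢γ)) }
    where
    maximal : ¬ (∃[ ρ ] K ρ × γ ⊆ ρ × ρ ≢ γ) → ∀ ρ → K ρ → γ ⊆ ρ → ρ ≡ γ
    maximal ¬larger ρ Kρ γ⊆ρ = decidable-stable (ρ ≟ₛ γ) (λ ρ≢γ → ¬larger (ρ , Kρ , γ⊆ρ , ρ≢γ))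

    no-larger : ∀ m {ρ} → n ≤ m + ∣ γ ∣ → K ρ → γ ⊆ ρ → ∣ γ ∣ < ∣ ρ ∣ → ⊥
    no-larger zero {ρ} bound _ _ γ<ρ = ℕ.<-irrefl refl (ℕ.<-≤-trans γ<ρ (ℕ.≤-trans (∣p∣≤n ρ) bound))
    no-larger (suc m) {ρ} bound Kρ γ⊆ρ γ<ρ =
      ¬¬-facet-above m bound′ Kρ (λ (F , facet , ρ⊆F) → ¬facet (F , facet , ⊆-trans γ⊆ρ ρ⊆F))
      where
      bound′ : n ≤ m + ∣ ρ ∣
      bound′ = ℕ.≤-trans bound (ℕ.≤-trans (ℕ.≤-reflexive (sym (ℕ.+-suc m ∣ γ ∣))) (ℕ.+-monoʳ-≤ m γ<ρ))

  freeFace-coface-⊆ : ∀ {π τ γ} → FreeFace K π τ → K γ → π ⊆ γ → γ ⊆ τ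
  freeFace-coface-⊆ {τ = τ} {γ} (_ , _ , unique) Kγ π⊆γ = decidable-stable (γ ⊆? τ) λ γ⊈τ →
    ¬¬-facet-above n (ℕ.m≤m+n n _) Kγ λ (F , facet , γ⊆F) →
      γ⊈τ (subst (γ ⊆_) (unique F facet (⊆-trans π⊆γ γ⊆F)) γ⊆F)

-- Collapsing cones

Coned : (Subset n → Set) → Fin n → Subset n → Set
Coned T c γ = ∃[ ρ ] T ρ × ρ ⊆ γ × γ ⊆ ρ ∪ ⁅ c ⁆

Coned-map : ∀ {T U : Subset n → Set} {c} → (∀ {ρ} → T ρ → U ρ) → Coned T c γ → Coned U c γ
Coned-map f (ρ , t , ρ⊆γ , γ⊆ρ+c) = ρ , f t , ρ⊆γ , γ⊆ρ+c

Coned-⊆ : ∀ {T : Subset n → Set} {c U} → (∀ {ρ} → T ρ → ρ ⊆ U) → c ∈ U → Coned T c γ → γ ⊆ U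
Coned-⊆ T⊆U c∈U (ρ , t , _ , γ⊆ρ+c) = ⊆-trans γ⊆ρ+c (∪⁅⁆⊆ (T⊆U t) c∈U)

coned-trace : ∀ {P : Subset n → Set} {S c} → (∀ {x} → x ∈ γ → x ≢ c → x ∈ S) → P (γ ∩ S) →
              Coned (λ ρ → ρ ⊆ S × P ρ) c γ
coned-trace {γ = γ} {S = S} γ-c⊆S Pγ∩S = γ ∩ S , (p∩q⊆q γ S , Pγ∩S) , p∩q⊆p γ S , ⊆-∩∪⁅⁆ γ-c⊆S

cone-base : ∀ {S : Subset n} → y ∉ S → ρ ⊆ S → ρ ⊆ γ → γ ⊆ ρ ∪ ⁅ y ⁆ → γ ∩ S ≡ ρ
cone-base {ρ = ρ} {γ = γ} {S} y∉S ρ⊆S ρ⊆γ γ⊆ρ+y = ⊆-antisym γ∩S⊆ρ (λ m → x∈p∩q⁺ (ρ⊆γ m , ρ⊆S m))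
  where
  γ∩S⊆ρ : γ ∩ S ⊆ ρ
  γ∩S⊆ρ m with x∈p∩q⁻ γ S m
  ... | x∈γ , x∈S with x∈p∪⁅y⁆⁻ (γ⊆ρ+y x∈γ)
  ...   | inj₁ x∈ρ = x∈ρ
  ...   | inj₂ refl = ⊥-elim (y∉S x∈S)

module ConeCollapse (K : Complex n) {S : Subset n} {c : Fin n} (c∉S : c ∉ S)
  {P : Subset n → Set} (P? : Decidable P) (P-mono : ∀ {ρ τ} → ρ ⊆ τ → P ρ → P τ)
  (cone-bounded : ∀ {ρ γ} → ρ ⊆ S → P ρ → K γ → ρ ⊆ γ → γ ⊆ S ∪ ⁅ c ⁆)
  (cone∈K : ∀ {ρ} → ρ ⊆ S → P ρ → K (ρ ∪ ⁅ c ⁆)) where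

  Base : Subset n → Set
  Base ρ = ρ ⊆ S × P ρ

  private
    _∈ₗ?_ : ∀ (ρ : Subset n) βs → Dec (ρ ∈ₗ βs)
    ρ ∈ₗ? βs = Any.any? (ρ ≟ₛ_) βs

    Removed : List (Subset n) → Subset n → Set
    Removed pending ρ = Base ρ × ρ ∉ₗ pending

    Stage : List (Subset n) → Complex n
    Stage pending γ = K γ × ¬ Coned (Removed pending) c γ

    above-base-split : ∀ {ρ γ} → Base ρ → K γ → ρ ⊆ γ → γ ⊆ (γ ∩ S) ∪ ⁅ c ⁆
    above-base-split (ρ⊆S , Pρ) Kγ ρ⊆γ =
      ⊆-∩∪⁅⁆ λ x∈γ → x∈p∪⁅y⁆∧x≢y⇒x∈p (cone-bounded ρ⊆S Pρ Kγ ρ⊆γ x∈γ)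

    module Collapse {β : Subset n} {βs : List (Subset n)}
      (β-first : All (NotProperSubset β) βs) (base : Base β) (β∉βs : β ∉ₗ βs) where

      τ : Subset n
      τ = β ∪ ⁅ c ⁆

      β⊆γ∩S : ∀ {γ} → β ⊆ γ → β ⊆ γ ∩ S
      β⊆γ∩S β⊆γ m = x∈p∩q⁺ (β⊆γ m , proj₁ base m)

      -- The trace γ ∩ S is a base containing β; a larger base would come earlier in the order,
      -- so its cone, which contains γ, would already be gone.
      above-β-trace : ∀ {γ} → Stage (β ∷ βs) γ → β ⊆ γ → γ ∩ S ≡ β
      above-β-trace {γ} (Kγ , ¬coned) β⊆γ with (γ ∩ S) ∈ₗ? (β ∷ βs)
      ... | yes (here γ∩S≡β) = γ∩S≡β
      ... | yes (there γ∩S∈βs) = sym (All.lookup β-first γ∩S∈βs (β⊆γ∩S β⊆γ))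
      ... | no γ∩S∉ = ⊥-elim (¬coned (γ ∩ S , (base′ , γ∩S∉) , p∩q⊆p γ S , above-base-split base Kγ β⊆γ))
        where
        base′ : Base (γ ∩ S)
        base′ = p∩q⊆q γ S , P-mono (β⊆γ∩S β⊆γ) (proj₂ base)

      above-β⊆τ : ∀ {γ} → Stage (β ∷ βs) γ → β ⊆ γ → γ ⊆ τ
      above-β⊆τ {γ} st β⊆γ =
        subst (λ b → γ ⊆ b ∪ ⁅ c ⁆) (above-β-trace st β⊆γ) (above-base-split base (proj₁ st) β⊆γ)

      τ∈Stage : Stage (β ∷ βs) τ
      τ∈Stage = cone∈K (proj₁ base) (proj₂ base) , λ (ρ , (base-ρ , ρ∉) , ρ⊆τ , τ⊆ρ+c) →
        ρ∉ (here (trans (sym (cone-base c∉S (proj₁ base-ρ) ρ⊆τ τ⊆ρ+c))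
                        (cone-base c∉S (proj₁ base) (p⊆p∪q _) ⊆-refl)))

      τ-facet : Facet (Stage (β ∷ βs)) τ
      τ-facet = τ∈Stage , λ ρ stρ τ⊆ρ → ⊆-antisym (above-β⊆τ stρ (⊆-trans (p⊆p∪q _) τ⊆ρ)) τ⊆ρ

      β-free : FreeFace (Stage (β ∷ βs)) β τ
      β-free = (p⊆p∪q _ , c , y∈p∪⁅y⁆ , c∉S ∘ proj₁ base) , τ-facet ,
        λ ρ (stρ , max) β⊆ρ → sym (max τ τ∈Stage (above-β⊆τ stρ β⊆ρ))

      removed-split : ∀ {ρ} → Removed βs ρ → Removed (β ∷ βs) ρ ⊎ ρ ≡ β
      removed-split {ρ} (base-ρ , ρ∉βs) with ρ ≟ₛ β
      ... | yes ρ≡β = inj₂ ρ≡β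
      ... | no ρ≢β = inj₁ (base-ρ , λ { (here ρ≡β) → ρ≢β ρ≡β ; (there ρ∈βs) → ρ∉βs ρ∈βs })

      stage-collapse : ElemCollapse (Stage (β ∷ βs)) (Stage βs)
      stage-collapse = β , τ , β-free , λ γ → mk⇔
        (λ (Kγ , ¬coned) → (Kγ , ¬coned ∘ Coned-map (Product.map₂ (_∘ there)))
                          , λ (β⊆γ , γ⊆τ) → ¬coned (β , (base , β∉βs) , β⊆γ , γ⊆τ))
        (λ ((Kγ , ¬coned) , ¬[β,τ]) → Kγ , λ (ρ , r , ρ⊆γ , γ⊆ρ+c) → case removed-split r of λ
          { (inj₁ r′) → ¬coned (ρ , r′ , ρ⊆γ , γ⊆ρ+c)
          ; (inj₂ refl) → ¬[β,τ] (ρ⊆γ , γ⊆ρ+c) })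

    skip : ∀ {β βs} → ¬ (Base β × β ∉ₗ βs) → Stage (β ∷ βs) ≐ Stage βs
    skip {β} {βs} ¬new γ = mk⇔
      (Product.map₂ (_∘ Coned-map added))
      (Product.map₂ (_∘ Coned-map (Product.map₂ (_∘ there))))
      where
      added : ∀ {ρ} → Removed βs ρ → Removed (β ∷ βs) ρ
      added (base-ρ , ρ∉βs) = base-ρ , λ { (here refl) → ¬new (base-ρ , ρ∉βs) ; (there ρ∈βs) → ρ∉βs ρ∈βs }

    stages : ∀ βs → AllPairs NotProperSubset βs → Stage βs ↘ Stage []
    stages [] _ = done (λ _ → ⇔.refl)
    stages (β ∷ βs) (β-first ∷ rest) with ((β ⊆? S) ×-dec P? β) ×-dec ¬? (β ∈ₗ? βs)
    ... | yes (base , β∉βs) = step (Stage βs) (Collapse.stage-collapse β-first base β∉βs) (stages βs rest)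
    ... | no ¬new = ↘-respˡ-≐ (skip ¬new) (stages βs rest)

  collapse-cones : K ↘ (λ γ → K γ × ¬ Coned Base c γ)
  collapse-cones = ↘-respˡ-≐ start (↘-respʳ-≐ (stages (subsets n) (subsets-supersets-first n)) finish)
    where
    start : K ≐ Stage (subsets n)
    start γ = mk⇔ (λ Kγ → Kγ , λ (ρ , (_ , ρ∉) , _) → ρ∉ (∈-subsets ρ)) proj₁
    finish : Stage [] ≐ (λ γ → K γ × ¬ Coned Base c γ)
    finish γ = mk⇔ (Product.map₂ (_∘ Coned-map (_, λ ())))
                   (Product.map₂ (_∘ Coned-map proj₁))

-- Crossing faces of σ

module Setting {n} (K : Complex n) (K-closed : ∀ ρ τ → ρ ⊆ τ → K τ → K ρ)
  (k' : ℕ) (l : Fin (suc k') → ℕ) (a : Σ (Fin (suc k')) (λ j → Fin (l j)) → Fin n)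
  (a-injective : Injective _≡_ _≡_ a) (C : Subset n) (a∉C : ∀ p → a p ∉ C)
  (σ : Subset n) (σ≡ : σ ≡ ⋃ (map (block l a) (allFin (suc k'))) ∪ C) (Kσ : K σ)
  (crossing-free : ∀ i j (s : Fin (l i)) (t : Fin (l j)) → i ≢ j →
                   FreeFace K (pair (a (i , s)) (a (j , t))) σ)
  where

  Idx : Set
  Idx = Σ (Fin (suc k')) (λ j → Fin (l j))

  A : Fin (suc k') → Subset n
  A = block l a

  x∈A⁻ : ∀ {x j} → x ∈ A j → ∃[ s ] x ≡ a (j , s)
  x∈A⁻ m = Product.map₂ (x∈⁅y⁆⇒x≡y _) (any-map-allFin⁻ (x∈⋃⁻ _ m))

  a∈A : ∀ p → a p ∈ A (proj₁ p)
  a∈A (j , s) = x∈⋃⁺ (any-map-allFin⁺ s (x∈⁅x⁆ (a (j , s))))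

  a∈A⇒≡ : ∀ {p j} → a p ∈ A j → proj₁ p ≡ j
  a∈A⇒≡ m = cong proj₁ (a-injective (proj₂ (x∈A⁻ m)))

  a≢ : ∀ {p q} → proj₁ p ≢ proj₁ q → a p ≢ a q
  a≢ i≢j ap≡aq = i≢j (cong proj₁ (a-injective ap≡aq))

  x∈σ⁻ : ∀ {x} → x ∈ σ → (∃[ p ] x ≡ a p) ⊎ x ∈ C
  x∈σ⁻ {x} m with x∈p∪q⁻ _ C (subst (x ∈_) σ≡ m)
  ... | inj₂ x∈C = inj₂ x∈C
  ... | inj₁ x∈⋃A with any-map-allFin⁻ (x∈⋃⁻ _ x∈⋃A)
  ...   | j , x∈Aj with x∈A⁻ x∈Aj
  ...     | s , x≡a = inj₁ ((j , s) , x≡a)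

  A⊆σ : ∀ j → A j ⊆ σ
  A⊆σ j {x} m = subst (x ∈_) (sym σ≡) (x∈p∪q⁺ (inj₁ (x∈⋃⁺ (any-map-allFin⁺ j m))))

  C⊆σ : C ⊆ σ
  C⊆σ {x} m = subst (x ∈_) (sym σ≡) (x∈p∪q⁺ (inj₂ m))

  a∈σ : ∀ p → a p ∈ σ
  a∈σ p = A⊆σ (proj₁ p) (a∈A p)

  Crossing : Subset n → Set
  Crossing γ = ∃[ p ] ∃[ q ] proj₁ p ≢ proj₁ q × a p ∈ γ × a q ∈ γ

  Crossing-mono : ∀ {γ δ} → γ ⊆ δ → Crossing γ → Crossing δ
  Crossing-mono γ⊆δ (p , q , i≢j , ap , aq) = p , q , i≢j , γ⊆δ ap , γ⊆δ aq

  any-Idx? : ∀ {Q : Idx → Set} → Decidable Q → Dec (∃ Q)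
  any-Idx? Q? = map′ (λ (i , s , q) → (i , s) , q) (λ ((i , s) , q) → i , s , q)
                     (any? λ i → any? λ s → Q? (i , s))

  Crossing? : Decidable Crossing
  Crossing? γ = any-Idx? λ p → any-Idx? λ q →
    ¬? (proj₁ p ≟ᶠ proj₁ q) ×-dec (a p ∈? γ) ×-dec (a q ∈? γ)

  crossing⇒⊆σ : ∀ {γ} → K γ → Crossing γ → γ ⊆ σ
  crossing⇒⊆σ Kγ ((i , s) , (j , t) , i≢j , ap , aq) =
    freeFace-coface-⊆ K (crossing-free i j s t i≢j) Kγ (pair⊆ ap aq)

  ¬crossing-⊆A∪C : ∀ {γ j} → γ ⊆ A j ∪ C → ¬ Crossing γ
  ¬crossing-⊆A∪C {j = j} γ⊆ (p , q , i≢j , ap , aq) =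
    i≢j (trans (in-block (γ⊆ ap)) (sym (in-block (γ⊆ aq))))
    where
    in-block : ∀ {p} → a p ∈ A j ∪ C → proj₁ p ≡ j
    in-block {p} m = Sum.[ a∈A⇒≡ , (λ ap∈C → ⊥-elim (a∉C p ap∈C)) ] (x∈p∪q⁻ (A j) C m)

  ¬crossing⇒⊆A∪C : ∀ {γ} → γ ⊆ σ → ¬ Crossing γ → ∃[ j ] γ ⊆ A j ∪ C
  ¬crossing⇒⊆A∪C {γ} γ⊆σ ¬cr with any? (λ x → (x ∈? γ) ×-dec ¬? (x ∈? C))
  ... | no ∄ = fromℕ k' , λ {x} m →   -- γ ⊆ C, so any block will do
    x∈p∪q⁺ (inj₂ (decidable-stable (x ∈? C) (λ x∉C → ∄ (x , m , x∉C))))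
  ... | yes (x , x∈γ , x∉C) with x∈σ⁻ (γ⊆σ x∈γ)
  ...   | inj₂ x∈C = ⊥-elim (x∉C x∈C)
  ...   | inj₁ (p , refl) = proj₁ p , λ m → x∈p∪q⁺ (in-block m)
    where
    in-block : ∀ {y} → y ∈ γ → y ∈ A (proj₁ p) ⊎ y ∈ C
    in-block {y} m with x∈σ⁻ (γ⊆σ m)
    ... | inj₂ y∈C = inj₂ y∈C
    ... | inj₁ (q , refl) with proj₁ q ≟ᶠ proj₁ p
    ...   | yes i≡j = inj₁ (subst (λ i → a q ∈ A i) i≡j (a∈A q))
    ...   | no i≢j = ⊥-elim (¬cr (q , p , i≢j , m , x∈γ))

  CrossingCone : Subset n → Fin n → Subset n → Set
  CrossingCone S c = Coned (λ ρ → ρ ⊆ S × Crossing ρ) c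

  CrossingCone⇒Crossing : ∀ {S c γ} → CrossingCone S c γ → Crossing γ
  CrossingCone⇒Crossing (_ , (_ , cr) , ρ⊆γ , _) = Crossing-mono ρ⊆γ cr

  CrossingCone-⊆ : ∀ {S U c γ} → S ⊆ U → c ∈ U → CrossingCone S c γ → γ ⊆ U
  CrossingCone-⊆ S⊆U = Coned-⊆ (λ (ρ⊆S , _) → ⊆-trans ρ⊆S S⊆U)

  collapse-crossing-cones : (L : Complex n) {S : Subset n} {c : Fin n} → c ∉ S
    → (∀ {ρ γ} → ρ ⊆ S → Crossing ρ → L γ → ρ ⊆ γ → γ ⊆ S ∪ ⁅ c ⁆)
    → (∀ {ρ} → ρ ⊆ S → Crossing ρ → L (ρ ∪ ⁅ c ⁆))
    → L ↘ (λ γ → L γ × ¬ CrossingCone S c γ)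
  collapse-crossing-cones L c∉S = ConeCollapse.collapse-cones L c∉S Crossing? Crossing-mono

  collapse-crossings-avoiding : ∀ {c} → c ∈ σ → K ↘ (λ γ → K γ × ¬ CrossingCone (σ - c) c γ)
  collapse-crossings-avoiding c∈σ = collapse-crossing-cones K (λ m → proj₂ (x∈p-y⁻ m) refl)
    (λ _ cr Kγ ρ⊆γ → ⊆-trans (crossing⇒⊆σ Kγ (Crossing-mono ρ⊆γ cr)) p⊆p-y∪⁅y⁆)
    (λ ρ⊆σ-c _ → K-closed _ σ (∪⁅⁆⊆ (⊆-trans ρ⊆σ-c (p─q⊆p σ _)) c∈σ) Kσ)

  crossing⇒cone : ∀ {c γ} → γ ⊆ σ → Crossing (γ - c) → CrossingCone (σ - c) c γ
  crossing⇒cone {c} {γ} γ⊆σ cr = coned-trace (λ x∈γ → x∈p∧x≢y⇒x∈p-y (γ⊆σ x∈γ))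
    (Crossing-mono γ-c⊆ cr)
    where
    γ-c⊆ : γ - c ⊆ γ ∩ (σ - c)
    γ-c⊆ m = let x∈γ , x≢c = x∈p-y⁻ m in x∈p∩q⁺ (x∈γ , x∈p∧x≢y⇒x∈p-y (γ⊆σ x∈γ) x≢c)

  collapse-onto-blocks∪C : ∀ {c} → c ∈ C → CollapsesOnto K σ (gens₂ l a C)
  collapse-onto-blocks∪C {c} c∈C = ↘-respʳ-≐ (collapse-crossings-avoiding c∈σ)
    λ γ → mk⇔ (Product.map₂ ¬cone⇒spanned) (Product.map₂ spanned⇒¬cone)
    where
    c∈σ : c ∈ σ
    c∈σ = C⊆σ c∈C

    a∈-c : ∀ {γ} p → a p ∈ γ → a p ∈ γ - c
    a∈-c p m = x∈p∧x≢y⇒x∈p-y m (λ ap≡c → a∉C p (subst (_∈ C) (sym ap≡c) c∈C))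

    ¬cone⇒spanned : ∀ {γ} → ¬ CrossingCone (σ - c) c γ → γ ⊆ σ → Spanned (gens₂ l a C) γ
    ¬cone⇒spanned {γ} ¬cone γ⊆σ with Crossing? γ
    ... | yes (p , q , i≢j , ap , aq) =
          ⊥-elim (¬cone (crossing⇒cone γ⊆σ (p , q , i≢j , a∈-c p ap , a∈-c q aq)))
    ... | no ¬cr = let j , γ⊆ = ¬crossing⇒⊆A∪C γ⊆σ ¬cr in any-map-allFin⁺ j γ⊆

    spanned⇒¬cone : ∀ {γ} → (γ ⊆ σ → Spanned (gens₂ l a C) γ) → ¬ CrossingCone (σ - c) c γ
    spanned⇒¬cone span cone with any-map-allFin⁻ (span (CrossingCone-⊆ (p─q⊆p σ _) c∈σ cone))
    ... | j , γ⊆ = ¬crossing-⊆A∪C γ⊆ (CrossingCone⇒Crossing cone)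

  module CollapseOntoBlocksAndPairs (C≡∅ : C ≡ ∅) (nonempty : ∀ j → 0 < l j) where

    last : Fin (suc k') → Idx
    last i = i , lastIdx (l i) (nonempty i)

    v : Fin n
    v = a (last (fromℕ k'))

    u : Fin k' → Fin n
    u j = a (last (inject₁ j))

    a≡last⇒≡ : ∀ {p i} → a p ≡ a (last i) → proj₁ p ≡ i
    a≡last⇒≡ e = cong proj₁ (a-injective e)

    ≡last-in-block : ∀ {r i i′} → a r ∈ A i → a r ≡ a (last i′) → a r ≡ a (last i)
    ≡last-in-block ar∈A e = trans e (cong (a ∘ last) (trans (sym (a≡last⇒≡ e)) (a∈A⇒≡ ar∈A)))

    inject₁≢fromℕ : ∀ {j : Fin k'} → inject₁ j ≢ fromℕ k'
    inject₁≢fromℕ e = fromℕ≢inject₁ (sym e)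

    a∈A-inject₁⇒≢v : ∀ {p j} → a p ∈ A (inject₁ j) → a p ≢ v
    a∈A-inject₁⇒≢v m ap≡v = inject₁≢fromℕ (trans (sym (a∈A⇒≡ m)) (a≡last⇒≡ ap≡v))

    x∉C : ∀ {x} → x ∉ C
    x∉C {x} x∈C = ∉⊥ (subst (x ∈_) C≡∅ x∈C)

    A∪C⊆A : ∀ {i} → A i ∪ C ⊆ A i
    A∪C⊆A {i} m = Sum.[ (λ x∈A → x∈A) , ⊥-elim ∘ x∉C ] (x∈p∪q⁻ (A i) C m)

    x∈σ⁻′ : ∀ {x} → x ∈ σ → ∃[ p ] x ≡ a p
    x∈σ⁻′ m = Sum.[ (λ x≡ap → x≡ap) , ⊥-elim ∘ x∉C ] (x∈σ⁻ m)

    K₁ : Complex n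
    K₁ γ = K γ × ¬ CrossingCone (σ - v) v γ

    K₁-same-block : ∀ {γ r x} → K₁ γ → γ ⊆ σ → a r ∈ γ → a r ≢ v → x ∈ γ → x ≢ v → x ∈ A (proj₁ r)
    K₁-same-block {r = r} (_ , ¬cone) γ⊆σ ar∈γ ar≢v x∈γ x≢v with x∈σ⁻′ (γ⊆σ x∈γ)
    ... | p , refl with proj₁ p ≟ᶠ proj₁ r
    ...   | yes i≡j = subst (λ i → a p ∈ A i) i≡j (a∈A p)
    ...   | no i≢j = ⊥-elim (¬cone (crossing⇒cone γ⊆σ
                        (p , r , i≢j , x∈p∧x≢y⇒x∈p-y x∈γ x≢v , x∈p∧x≢y⇒x∈p-y ar∈γ ar≢v)))

    S : Fin k' → Subset n
    S j = (A (inject₁ j) - u j) ∪ ⁅ v ⁆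

    x∈S⁻ : ∀ {j x} → x ∈ S j → (x ∈ A (inject₁ j) × x ≢ u j) ⊎ x ≡ v
    x∈S⁻ m = Sum.map₁ x∈p-y⁻ (x∈p∪⁅y⁆⁻ m)

    x∈S⁺ : ∀ {j x} → x ∈ A (inject₁ j) → x ≢ u j → x ∈ S j
    x∈S⁺ x∈A x≢u = p⊆p∪q _ (x∈p∧x≢y⇒x∈p-y x∈A x≢u)

    S∪u⊆A∪v : ∀ {j} → S j ∪ ⁅ u j ⁆ ⊆ A (inject₁ j) ∪ ⁅ v ⁆
    S∪u⊆A∪v {j} = ∪⁅⁆⊆ (∪⁅⁆⊆ (⊆-trans (p─q⊆p _ _) (p⊆p∪q _)) y∈p∪⁅y⁆) (p⊆p∪q _ (a∈A (last (inject₁ j))))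

    u∉S : ∀ {j} → u j ∉ S j
    u∉S m = Sum.[ (λ (_ , u≢u) → u≢u refl) , a∈A-inject₁⇒≢v (a∈A (last (inject₁ _))) ] (x∈S⁻ m)

    S⊆σ : ∀ {j} → S j ⊆ σ
    S⊆σ {j} = ∪⁅⁆⊆ (⊆-trans (p─q⊆p _ _) (A⊆σ (inject₁ j))) (a∈σ _)

    crossing-⊆S⇒block-vertex : ∀ {j ρ} → ρ ⊆ S j → Crossing ρ →
      ∃[ r ] a r ∈ ρ × a r ∈ A (inject₁ j) × a r ≢ u j
    crossing-⊆S⇒block-vertex ρ⊆S (p , q , i≢j , ap , aq) with x∈S⁻ (ρ⊆S ap) | x∈S⁻ (ρ⊆S aq)
    ... | inj₁ (ap∈A , ap≢u) | _ = p , ap , ap∈A , ap≢u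
    ... | inj₂ _ | inj₁ (aq∈A , aq≢u) = q , aq , aq∈A , aq≢u
    ... | inj₂ ap≡v | inj₂ aq≡v = ⊥-elim (a≢ i≢j (trans ap≡v (sym aq≡v)))

    K₂ : List (Fin k') → Complex n
    K₂ js γ = K₁ γ × All (λ j → ¬ CrossingCone (S j) (u j) γ) js

    collapse-cones-at : ∀ j js → All (j ≢_) js → K₂ js ↘ K₂ (j ∷ js)
    collapse-cones-at j js j∉js = ↘-respʳ-≐ (collapse-crossing-cones (K₂ js) u∉S bounded cone∈K₂)
      (λ γ → mk⇔ (λ ((K₁γ , ¬cones) , ¬cone) → K₁γ , ¬cone ∷ ¬cones)
                 (λ { (K₁γ , ¬cone ∷ ¬cones) → (K₁γ , ¬cones) , ¬cone }))
      where
      bounded : ∀ {ρ γ} → ρ ⊆ S j → Crossing ρ → K₂ js γ → ρ ⊆ γ → γ ⊆ S j ∪ ⁅ u j ⁆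
      bounded {γ = γ} ρ⊆S cr (K₁γ , _) ρ⊆γ {x} x∈γ with crossing-⊆S⇒block-vertex ρ⊆S cr
      ... | r , ar∈ρ , ar∈A , _ with x ≟ᶠ v | x ≟ᶠ u j
      ...   | yes refl | _ = p⊆p∪q _ y∈p∪⁅y⁆
      ...   | no _ | yes refl = y∈p∪⁅y⁆
      ...   | no x≢v | no x≢u = p⊆p∪q _ (x∈S⁺ (subst (λ i → x ∈ A i) (a∈A⇒≡ ar∈A) x∈A) x≢u)
        where
        γ⊆σ : γ ⊆ σ
        γ⊆σ = crossing⇒⊆σ (proj₁ K₁γ) (Crossing-mono ρ⊆γ cr)
        x∈A : x ∈ A (proj₁ r)
        x∈A = K₁-same-block K₁γ γ⊆σ (ρ⊆γ ar∈ρ) (a∈A-inject₁⇒≢v ar∈A) x∈γ x≢v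

      cone∈K₂ : ∀ {ρ} → ρ ⊆ S j → Crossing ρ → K₂ js (ρ ∪ ⁅ u j ⁆)
      cone∈K₂ {ρ} ρ⊆S _ =
        (K-closed _ σ (∪⁅⁆⊆ (⊆-trans ρ⊆S S⊆σ) (a∈σ _)) Kσ , ¬cone-v) , All.map ¬cone-other j∉js
        where
        ρ+u⊆A∪v : ρ ∪ ⁅ u j ⁆ ⊆ A (inject₁ j) ∪ ⁅ v ⁆
        ρ+u⊆A∪v = ⊆-trans (∪⁅⁆⊆ (⊆-trans ρ⊆S (p⊆p∪q _)) y∈p∪⁅y⁆) S∪u⊆A∪v

        ¬cone-v : ¬ CrossingCone (σ - v) v (ρ ∪ ⁅ u j ⁆)
        ¬cone-v (ρ′ , (ρ′⊆σ-v , cr) , ρ′⊆ , _) = ¬crossing-⊆A∪C ρ′⊆A∪C cr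
          where
          ρ′⊆A∪C : ρ′ ⊆ A (inject₁ j) ∪ C
          ρ′⊆A∪C m = p⊆p∪q C (x∈p∪⁅y⁆∧x≢y⇒x∈p (ρ+u⊆A∪v (ρ′⊆ m)) (proj₂ (x∈p-y⁻ (ρ′⊆σ-v m))))

        ¬cone-other : ∀ {j′} → j ≢ j′ → ¬ CrossingCone (S j′) (u j′) (ρ ∪ ⁅ u j ⁆)
        ¬cone-other {j′} j≢j′ cone = j≢j′ (inject₁-injective (a∈A⇒≡ u∈A))
          where
          u∈A : u j ∈ A (inject₁ j′)
          u∈A = x∈p∪⁅y⁆∧x≢y⇒x∈p (S∪u⊆A∪v (CrossingCone-⊆ (p⊆p∪q _) y∈p∪⁅y⁆ cone y∈p∪⁅y⁆))
                                 (a∈A-inject₁⇒≢v (a∈A (last (inject₁ j))))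

    collapse-all-cones : ∀ js → AllPairs _≢_ js → K₁ ↘ K₂ js
    collapse-all-cones [] _ = done (λ γ → mk⇔ (_, []) proj₁)
    collapse-all-cones (j ∷ js) (j∉js ∷ distinct) =
      ↘-trans (collapse-all-cones js distinct) (collapse-cones-at j js j∉js)

    ¬crossing-⊆⁅⁆ : ∀ {ρ x} → ρ ⊆ ⁅ x ⁆ → ¬ Crossing ρ
    ¬crossing-⊆⁅⁆ {x = x} ρ⊆x (p , q , i≢j , ap , aq) =
      a≢ i≢j (trans (x∈⁅y⁆⇒x≡y x (ρ⊆x ap)) (sym (x∈⁅y⁆⇒x≡y x (ρ⊆x aq))))

    K₁-non-v-block : ∀ {γ r} → K₁ γ → γ ⊆ σ → a r ∈ γ → proj₁ r ≢ fromℕ k' →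
      ∃[ j ] γ ⊆ A (inject₁ j) ∪ ⁅ v ⁆
    K₁-non-v-block {γ} {r} K₁γ γ⊆σ ar∈γ r≢k = lower₁ (proj₁ r) k≢r , γ⊆
      where
      k≢r : k' ≢ toℕ (proj₁ r)
      k≢r e = r≢k (toℕ-injective (trans (sym e) (sym (toℕ-fromℕ k'))))
      γ⊆ : γ ⊆ A (inject₁ (lower₁ (proj₁ r) k≢r)) ∪ ⁅ v ⁆
      γ⊆ {x} x∈γ with x ≟ᶠ v
      ... | yes refl = y∈p∪⁅y⁆
      ... | no x≢v = p⊆p∪q _ (subst (λ i → x ∈ A i) (sym (inject₁-lower₁ (proj₁ r) k≢r))
                       (K₁-same-block K₁γ γ⊆σ ar∈γ (r≢k ∘ a≡last⇒≡) x∈γ x≢v))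

    crossing-through-v : ∀ {γ} → K₁ γ → γ ⊆ σ → Crossing γ → v ∈ γ × ∃[ j ] γ ⊆ A (inject₁ j) ∪ ⁅ v ⁆
    crossing-through-v {γ} K₁γ γ⊆σ (p , q , i≢j , ap , aq) with a p ≟ᶠ v | a q ≟ᶠ v
    ... | yes ap≡v | _ = subst (_∈ γ) ap≡v ap ,
                         K₁-non-v-block K₁γ γ⊆σ aq (λ e → i≢j (trans (a≡last⇒≡ ap≡v) (sym e)))
    ... | no _ | yes aq≡v = subst (_∈ γ) aq≡v aq ,
                            K₁-non-v-block K₁γ γ⊆σ ap (λ e → i≢j (trans e (sym (a≡last⇒≡ aq≡v))))
    ... | no ap≢v | no aq≢v = ⊥-elim (proj₂ K₁γ (crossing⇒cone γ⊆σ
                                (p , q , i≢j , x∈p∧x≢y⇒x∈p-y ap ap≢v , x∈p∧x≢y⇒x∈p-y aq aq≢v)))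

    ¬cone⇒⊆pair : ∀ {j γ} → ¬ CrossingCone (S j) (u j) γ → v ∈ γ → γ ⊆ A (inject₁ j) ∪ ⁅ v ⁆ →
      γ ⊆ pair (u j) v
    ¬cone⇒⊆pair {j} {γ} ¬cone v∈γ γ⊆ {x} x∈γ with x ≟ᶠ v | x ≟ᶠ u j
    ... | yes refl | _ = q⊆p∪q ⁅ u j ⁆ ⁅ v ⁆ (x∈⁅x⁆ v)
    ... | no _ | yes refl = p⊆p∪q ⁅ v ⁆ (x∈⁅x⁆ (u j))
    ... | no x≢v | no x≢u = ⊥-elim (¬cone (coned-trace γ-u⊆S crossing))
      where
      γ-u⊆S : ∀ {y} → y ∈ γ → y ≢ u j → y ∈ S j
      γ-u⊆S {y} y∈γ y≢u with y ≟ᶠ v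
      ... | yes refl = y∈p∪⁅y⁆
      ... | no y≢v = x∈S⁺ (x∈p∪⁅y⁆∧x≢y⇒x∈p (γ⊆ y∈γ) y≢v) y≢u
      x∈A : x ∈ A (inject₁ j)
      x∈A = x∈p∪⁅y⁆∧x≢y⇒x∈p (γ⊆ x∈γ) x≢v
      crossing : Crossing (γ ∩ S j)
      crossing with x∈A⁻ x∈A
      ... | s , refl = (inject₁ j , s) , last (fromℕ k') , inject₁≢fromℕ ,
                       x∈p∩q⁺ (x∈γ , x∈S⁺ x∈A x≢u) , x∈p∩q⁺ (v∈γ , y∈p∪⁅y⁆)

    G : List (Subset n)
    G = gens₁ k' l a nonempty

    spanned-crossing⇒⊆pair : ∀ {γ} → Spanned G γ → Crossing γ → ∃[ j ] γ ⊆ pair (u j) v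
    spanned-crossing⇒⊆pair span cr with Any.++⁻ (map A (allFin (suc k'))) span
    ... | inj₁ in-block = let i , γ⊆A = any-map-allFin⁻ in-block
                          in ⊥-elim (¬crossing-⊆A∪C (p⊆p∪q C ∘ γ⊆A) cr)
    ... | inj₂ in-pair = any-map-allFin⁻ in-pair

    K₂-spanned : ∀ {γ} → K₂ (allFin k') γ → γ ⊆ σ → Spanned G γ
    K₂-spanned {γ} (K₁γ , ¬cones) γ⊆σ with Crossing? γ
    ... | no ¬cr = let i , γ⊆A∪C = ¬crossing⇒⊆A∪C γ⊆σ ¬cr
                   in Any.++⁺ˡ (any-map-allFin⁺ i (A∪C⊆A ∘ γ⊆A∪C))
    ... | yes cr = let v∈γ , j , γ⊆ = crossing-through-v K₁γ γ⊆σ cr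
                   in Any.++⁺ʳ _ (any-map-allFin⁺ j (¬cone⇒⊆pair (All.lookup ¬cones (∈-allFin j)) v∈γ γ⊆))

    spanned⇒K₂ : ∀ {γ} → K γ → (γ ⊆ σ → Spanned G γ) → K₂ (allFin k') γ
    spanned⇒K₂ {γ} Kγ span = (Kγ , ¬cone-v) , All.tabulate (λ {j} _ → ¬cone-at j)
      where
      ¬cone-v : ¬ CrossingCone (σ - v) v γ
      cone⇒⊆pair : ∀ {S c} → S ⊆ σ → c ∈ σ → CrossingCone S c γ → ∃[ j ] γ ⊆ pair (u j) v
      cone⇒⊆pair S⊆σ c∈σ cone =
        spanned-crossing⇒⊆pair (span (CrossingCone-⊆ S⊆σ c∈σ cone)) (CrossingCone⇒Crossing cone)

      ¬cone-v cone@(ρ , (ρ⊆σ-v , cr) , ρ⊆γ , _) with cone⇒⊆pair (p─q⊆p σ _) (a∈σ _) cone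
      ... | j , γ⊆pair = ¬crossing-⊆⁅⁆ ρ⊆u cr
        where
        ρ⊆u : ρ ⊆ ⁅ u j ⁆
        ρ⊆u m with x∈pair⁻ (γ⊆pair (ρ⊆γ m))
        ... | inj₁ refl = x∈⁅x⁆ (u j)
        ... | inj₂ x≡v = ⊥-elim (proj₂ (x∈p-y⁻ (ρ⊆σ-v m)) x≡v)

      ¬cone-at : ∀ j → ¬ CrossingCone (S j) (u j) γ
      ¬cone-at j cone@(ρ , (ρ⊆S , cr) , ρ⊆γ , _) with crossing-⊆S⇒block-vertex ρ⊆S cr
      ... | r , ar∈ρ , ar∈A , ar≢u with cone⇒⊆pair S⊆σ (a∈σ _) cone
      ...   | j′ , γ⊆pair with x∈pair⁻ (γ⊆pair (ρ⊆γ ar∈ρ))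
      ...     | inj₂ ar≡v = a∈A-inject₁⇒≢v ar∈A ar≡v
      ...     | inj₁ ar≡u′ = ar≢u (≡last-in-block ar∈A ar≡u′)

    collapse-onto-blocks-and-pairs : CollapsesOnto K σ G
    collapse-onto-blocks-and-pairs =
      ↘-respʳ-≐ (↘-trans (collapse-crossings-avoiding (a∈σ _))
                          (collapse-all-cones (allFin k') (allFin⁺ k')))
        λ γ → mk⇔ (λ K₂γ → proj₁ (proj₁ K₂γ) , K₂-spanned K₂γ) (λ (Kγ , span) → spanned⇒K₂ Kγ span)

corollary2p6 : ∀ {n} (K : Complex n) → IsComplex K
    → (k' : ℕ) (l : Fin (suc k') → ℕ)
    → (a : Σ (Fin (suc k')) (λ j → Fin (l j)) → Fin n) → Injective _≡_ _≡_ a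
    → (C : Subset n) → (∀ p → a p ∉ C)
    → (σ : Subset n) → σ ≡ ⋃ (map (block l a) (allFin (suc k'))) ∪ C
    → Facet K σ
    → (∀ i j (s : Fin (l i)) (t : Fin (l j)) → i ≢ j → FreeFace K (pair (a (i , s)) (a (j , t))) σ)
    → ((C ≡ ∅ → (nz : ∀ j → 0 < l j) → CollapsesOnto K σ (gens₁ k' l a nz))
    × (C ≢ ∅ → CollapsesOnto K σ (gens₂ l a C)))
corollary2p6 K (_ , K-closed) k' l a a-injective C a∉C σ σ≡ (Kσ , _) crossing-free =
  (λ C≡∅ nonempty → CollapseOntoBlocksAndPairs.collapse-onto-blocks-and-pairs C≡∅ nonempty) ,
  (λ C≢∅ → collapse-onto-blocks∪C (proj₂ (≢∅⇒Nonempty C≢∅)))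
  where open Setting K K-closed k' l a a-injective C a∉C σ σ≡ Kσ crossing-free
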